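{- Let $\Sigma_4=\{0,1,2,3\}$ and let $\mathbf w$ be any infinite word over $\Sigma_4$ that is squarefree and contains no occurrence of any of the subwords $12$, $13$, $21$, $32$, $231$, $10302$. Define the morphism $g:\Sigma_4^*\to\{0,1\}^*$ by $g(0)=010011$, $g(1)=010110$, $g(2)=011001$, $g(3)=011010$. Then $g(\mathbf w)$ is cubefree and contains no square $xx$ with $|x|\ge 4$.
   Context: A square is a nonempty word $xx$, a cube a nonempty word $xxx$. A word is squarefree (resp. cubefree) if no subword is a square (resp. cube). A morphism is applied to an infinite word letter by letter. -}

module Defs where

open import Data.Nat using (ℕ; zero; suc; _+_; _*_; _<_; _≥_; _/_; _%_)
open import Data.Nat.DivMod using (m%n<n)
open import Data.Fin as Fin using (Fin; fromℕ<)
open import Data.Fin.Patterns using (0F; 1F; 2F; 3F)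
open import Data.Bool using (Bool; true; false)
open import Data.List using (List; []; _∷_; length; lookup)
open import Data.Vec using (Vec; []; _∷_) renaming (lookup to vlookup)
open import Data.Product using (∃; _×_)
open import Relation.Binary.PropositionalEquality using (_≡_)
open import Relation.Nullary using (¬_)

InfWord : Set → Set
InfWord A = ℕ → A

Σ₄ : Set
Σ₄ = Fin 4

Σ₂ : Set
Σ₂ = Fin 2

OccursAt : {A : Set} → InfWord A → List A → ℕ → Set
OccursAt w u i = (k : Fin (length u)) → w (i + Fin.toℕ k) ≡ lookup u k

Contains : {A : Set} → InfWord A → List A → Set
Contains w u = ∃ λ i → OccursAt w u i

-- w has an occurrence of x^e (e copies of a word x of length n) at position i:
-- w(i + k) = w(i + k + n) for all k < (e-1)·n, i.e. the factor of length e·n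
-- starting at i has period n.
PowerAt : {A : Set} → InfWord A → (e n i : ℕ) → Set
PowerAt w e n i = (k : ℕ) → k + n < e * n → w (i + k) ≡ w (i + k + n)

HasSquareOfLength : {A : Set} → InfWord A → ℕ → Set
HasSquareOfLength w n = ∃ λ i → PowerAt w 2 n i

Squarefree : {A : Set} → InfWord A → Set
Squarefree w = (n : ℕ) → n ≥ 1 → ¬ HasSquareOfLength w n

Cubefree : {A : Set} → InfWord A → Set
Cubefree w = (n : ℕ) → n ≥ 1 → ¬ (∃ λ i → PowerAt w 3 n i)

applyUniform : {A B : Set} (m : ℕ) → (A → Vec B (suc m)) → InfWord A → InfWord B
applyUniform m h w p = vlookup (h (w (p / suc m))) (fromℕ< (m%n<n p (suc m)))

gImg : Σ₄ → Vec Σ₂ 6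
gImg Fin.zero                         = 0F ∷ 1F ∷ 0F ∷ 0F ∷ 1F ∷ 1F ∷ []

gImg (Fin.suc Fin.zero)               = 0F ∷ 1F ∷ 0F ∷ 1F ∷ 1F ∷ 0F ∷ []

gImg (Fin.suc (Fin.suc Fin.zero))     = 0F ∷ 1F ∷ 1F ∷ 0F ∷ 0F ∷ 1F ∷ []

gImg (Fin.suc (Fin.suc (Fin.suc Fin.zero))) = 0F ∷ 1F ∷ 1F ∷ 0F ∷ 1F ∷ 0F ∷ []

g : InfWord Σ₄ → InfWord Σ₂
g = applyUniform 5 gImg

-- Call w admissible if it satisfies the hypotheses. Only few words of length 4 are factors of
-- admissible words, and the image under g of such a 4-letter factor contains every factor of
-- g(w) of length at most 19 starting in its first block. Checking all of them rules out squares
-- of period 4 to 8 and cubes of period 1 to 3, and shows that every 9-bit factor of g(w)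
-- determines its starting position modulo 6. So a square xx with |x| ≥ 9 has |x| = 6m, and its
-- halves start at the same offset r inside blocks q and q + m. Then w(q + j) = w(q + m + j) for
-- 0 < j < m, while g(w(q + m)) consists of the first r bits of g(w(q + 2m)) followed by the last
-- 6 - r bits of g(w(q)). A second check shows that this forces w(q) = w(q + m) or
-- w(q + m) = w(q + 2m), each giving a square in w, or (w(q), w(q + m), w(q + 2m)) = (1, 3, 2),
-- which a short case analysis refutes using the forbidden factors.
module Submission where

open import Defs
open import Data.Nat using (ℕ; zero; suc; _+_; _*_; _∸_; _<_; _≤_; _≥_; _<?_; _≤?_; z≤n; s≤s; NonZero)
open import Data.List using (List; []; _∷_; lookup)
open import Data.Fin.Patterns using (0F; 1F; 2F; 3F; 4F)
open import Data.Nat.Properties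
open import Data.Nat.DivMod
  using (_/_; _%_; m≡m%n+[m/n]*n; m%n<n; [m+kn]%n≡m%n; +-distrib-/-∣ʳ; m<n⇒m/n≡0; m<n⇒m%n≡m; m*n/n≡m)
open import Algebra.Properties.CommutativeSemigroup +-commutativeSemigroup using (xy∙z≈xz∙y)
open import Data.Nat.Divisibility using (_∣_; divides; divides-refl; ∣m+n∣m⇒∣n)
open import Data.Nat.Tactic.RingSolver using (solve-∀)
open import Data.Fin as Fin using (toℕ; fromℕ<)
open import Data.Fin.Properties using (all?; toℕ<n; fromℕ<-cong)
open import Data.Bool using (Bool; true; false; T)
open import Data.Bool.Properties using (T?)
open import Data.Vec using (Vec; tabulate) renaming (lookup to vlookup; _∷_ to _∷ᵛ_; [] to []ᵛ)
open import Data.Vec.Properties using (tabulate-cong)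
open import Data.Product using (∃; _×_; _,_)
open import Data.Sum using (_⊎_; inj₁; inj₂; [_,_]′)
open import Data.Empty using (⊥; ⊥-elim)
open import Function using (_∘_; case_of_)
open import Relation.Nullary using (¬_; Dec; yes; no; ¬?; contradiction)
open import Relation.Nullary.Decidable using (toWitness; _×-dec_; _⊎-dec_; _→-dec_)
open import Relation.Binary.PropositionalEquality
  using (_≡_; _≢_; refl; sym; trans; cong; cong₂; subst; subst₂; module ≡-Reasoning)
open ≡-Reasoning

module _ {A : Set} (w : InfWord A) where

  PowerAt-periodic : ∀ e n i → PowerAt w (suc e) n i
    → ∀ k → k < e * n → w (i + k) ≡ w (i + k + n)
  PowerAt-periodic e n i P k k<en = P k (subst (_< n + e * n) (+-comm n k) (+-monoʳ-< n k<en))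

  square-periodic : ∀ n i → PowerAt w 2 n i → ∀ k → k < n → w (i + k) ≡ w (i + k + n)
  square-periodic n i P k k<n = PowerAt-periodic 1 n i P k (subst (k <_) (sym (*-identityˡ n)) k<n)

  square-periodic-interval : ∀ n i → PowerAt w 2 n i → ∀ p → i ≤ p → p < i + n → w p ≡ w (p + n)
  square-periodic-interval n i P p i≤p p<i+n =
    subst (λ x → w x ≡ w (x + n)) (m+[n∸m]≡n i≤p)
      (square-periodic n i P (p ∸ i) (subst (p ∸ i <_) (m+n∸m≡n i n) (∸-monoˡ-< p<i+n i≤p)))

  PowerAt-mono : ∀ {e e′} n i → e ≤ e′ → PowerAt w e′ n i → PowerAt w e n i
  PowerAt-mono n i e≤e′ P k lt = P k (≤-trans lt (*-monoˡ-≤ n e≤e′))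

%-equal⇒∣ : ∀ d .{{_ : NonZero d}} i n → i % d ≡ (i + n) % d → d ∣ n
%-equal⇒∣ d i n eq = ∣m+n∣m⇒∣n (divides ((i + n) / d) (+-cancelˡ-≡ (i % d) _ _ (begin
  i % d + (i / d * d + n)       ≡⟨ +-assoc (i % d) (i / d * d) n ⟨
  i % d + i / d * d + n         ≡⟨ cong (_+ n) (m≡m%n+[m/n]*n i d) ⟨
  i + n                         ≡⟨ m≡m%n+[m/n]*n (i + n) d ⟩
  (i + n) % d + (i + n) / d * d ≡⟨ cong (_+ (i + n) / d * d) eq ⟨
  i % d + (i + n) / d * d       ∎))) (divides-refl (i / d))

shift : {A : Set} → ℕ → InfWord A → InfWord A
shift q w p = w (q + p)

module _ {A : Set} (w : InfWord A) (q : ℕ) where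

  Contains-shift : ∀ {u} → Contains (shift q w) u → Contains w u
  Contains-shift (i , occ) = q + i , λ k → trans (cong w (+-assoc q i (toℕ k))) (occ k)

  PowerAt-shift : ∀ e n i → PowerAt (shift q w) e n i → PowerAt w e n (q + i)
  PowerAt-shift e n i P k lt = begin
    w (q + i + k)       ≡⟨ cong w (+-assoc q i k) ⟩
    w (q + (i + k))     ≡⟨ P k lt ⟩
    w (q + (i + k + n)) ≡⟨ cong w (+-assoc q (i + k) n) ⟨
    w (q + (i + k) + n) ≡⟨ cong (λ x → w (x + n)) (+-assoc q i k) ⟨
    w (q + i + k + n)   ∎

  Squarefree-shift : Squarefree w → Squarefree (shift q w)
  Squarefree-shift sf n 1≤n (i , P) = sf n 1≤n (q + i , PowerAt-shift 2 n i P)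

record Admissible (w : InfWord Σ₄) : Set where
  field
    squarefree : Squarefree w
    no-12      : ¬ Contains w (1F ∷ 2F ∷ [])
    no-13      : ¬ Contains w (1F ∷ 3F ∷ [])
    no-21      : ¬ Contains w (2F ∷ 1F ∷ [])
    no-32      : ¬ Contains w (3F ∷ 2F ∷ [])
    no-231     : ¬ Contains w (2F ∷ 3F ∷ 1F ∷ [])
    no-10302   : ¬ Contains w (1F ∷ 0F ∷ 3F ∷ 0F ∷ 2F ∷ [])

Admissible-shift : ∀ {w} q → Admissible w → Admissible (shift q w)
Admissible-shift {w} q adm = record
  { squarefree = Squarefree-shift w q squarefree
  ; no-12      = no-12 ∘ Contains-shift w q
  ; no-13      = no-13 ∘ Contains-shift w q
  ; no-21      = no-21 ∘ Contains-shift w q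
  ; no-32      = no-32 ∘ Contains-shift w q
  ; no-231     = no-231 ∘ Contains-shift w q
  ; no-10302   = no-10302 ∘ Contains-shift w q
  }
  where open Admissible adm

allowed : Σ₄ → Σ₄ → Bool
allowed 0F 1F = true
allowed 0F 2F = true
allowed 0F 3F = true
allowed 1F 0F = true
allowed 2F 0F = true
allowed 2F 3F = true
allowed 3F 0F = true
allowed 3F 1F = true
allowed _  _  = false

Admissible₄ : Σ₄ → Σ₄ → Σ₄ → Σ₄ → Set
Admissible₄ a b c d = T (allowed a b) × T (allowed b c) × T (allowed c d)
  × ¬ (a ≡ 2F × b ≡ 3F × c ≡ 1F) × ¬ (b ≡ 2F × c ≡ 3F × d ≡ 1F) × ¬ (a ≡ c × b ≡ d)

module AdmissibleLetters {w : InfWord Σ₄} (adm : Admissible w) where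
  open Admissible adm

  no-square : ∀ i {n} → 1 ≤ n → ¬ (∀ k → k < n → w (i + k) ≡ w (i + k + n))
  no-square i {n} 1≤n periodic = squarefree n 1≤n (i , λ k k+n<2n →
    periodic k (+-cancelʳ-< n k n (subst (k + n <_) (cong (n +_) (+-identityʳ n)) k+n<2n)))

  no-square′ : ∀ p {n} → 1 ≤ n → ¬ (∀ k → k < n → w (k + p) ≡ w (k + n + p))
  no-square′ p {n} 1≤n periodic = no-square p 1≤n λ k k<n →
    subst₂ (λ x y → w x ≡ w y) (+-comm k p)
      (trans (+-comm (k + n) p) (sym (+-assoc p k n))) (periodic k k<n)

  neighbours-distinct : ∀ p → w p ≢ w (1 + p)
  neighbours-distinct p e = no-square′ p (s≤s z≤n) λ { 0 _ → e ; (suc _) (s≤s ()) }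

  no-square-2 : ∀ p → w p ≡ w (2 + p) → w (1 + p) ≡ w (3 + p) → ⊥
  no-square-2 p e₀ e₁ = no-square′ p (s≤s z≤n)
    λ { 0 _ → e₀ ; 1 _ → e₁ ; (suc (suc _)) (s≤s (s≤s ())) }

  contains-at : ∀ p {u} → (∀ k → w (toℕ k + p) ≡ lookup u k) → Contains w u
  contains-at p h = p , λ k → trans (cong w (+-comm p (toℕ k))) (h k)

  allowed-pair : ∀ p → T (allowed (w p) (w (1 + p)))
  allowed-pair p with w p in e₀ | w (1 + p) in e₁
  ... | 0F | 0F = ⊥-elim (neighbours-distinct p (trans e₀ (sym e₁)))
  ... | 0F | 1F = _
  ... | 0F | 2F = _
  ... | 0F | 3F = _
  ... | 1F | 0F = _
  ... | 1F | 1F = ⊥-elim (neighbours-distinct p (trans e₀ (sym e₁)))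
  ... | 1F | 2F = ⊥-elim (no-12 (contains-at p λ { 0F → e₀ ; 1F → e₁ }))
  ... | 1F | 3F = ⊥-elim (no-13 (contains-at p λ { 0F → e₀ ; 1F → e₁ }))
  ... | 2F | 0F = _
  ... | 2F | 1F = ⊥-elim (no-21 (contains-at p λ { 0F → e₀ ; 1F → e₁ }))
  ... | 2F | 2F = ⊥-elim (neighbours-distinct p (trans e₀ (sym e₁)))
  ... | 2F | 3F = _
  ... | 3F | 0F = _
  ... | 3F | 1F = _
  ... | 3F | 2F = ⊥-elim (no-32 (contains-at p λ { 0F → e₀ ; 1F → e₁ }))
  ... | 3F | 3F = ⊥-elim (neighbours-distinct p (trans e₀ (sym e₁)))

  follows-1 : ∀ p → w p ≡ 1F → w (1 + p) ≡ 0F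
  follows-1 p e = only-0-after-1 (subst (λ a → T (allowed a (w (1 + p)))) e (allowed-pair p))
    where
    only-0-after-1 : ∀ {b} → T (allowed 1F b) → b ≡ 0F
    only-0-after-1 {0F} _ = refl

  precedes-2 : ∀ p → w (1 + p) ≡ 2F → w p ≡ 0F
  precedes-2 p e = only-0-before-2 (subst (T ∘ allowed (w p)) e (allowed-pair p))
    where
    only-0-before-2 : ∀ {a} → T (allowed a 2F) → a ≡ 0F
    only-0-before-2 {0F} _ = refl
    only-0-before-2 {1F} ()
    only-0-before-2 {2F} ()
    only-0-before-2 {3F} ()

  no-231-at : ∀ p → ¬ (w p ≡ 2F × w (1 + p) ≡ 3F × w (2 + p) ≡ 1F)
  no-231-at p (e₀ , e₁ , e₂) = no-231 (contains-at p λ { 0F → e₀ ; 1F → e₁ ; 2F → e₂ })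

  no-10302-at : ∀ p → w p ≡ 1F → w (1 + p) ≡ 0F → w (2 + p) ≡ 3F → w (3 + p) ≡ 0F
    → w (4 + p) ≡ 2F → ⊥
  no-10302-at p e₀ e₁ e₂ e₃ e₄ =
    no-10302 (contains-at p λ { 0F → e₀ ; 1F → e₁ ; 2F → e₂ ; 3F → e₃ ; 4F → e₄ })

  window-admissible : ∀ q → Admissible₄ (w q) (w (1 + q)) (w (2 + q)) (w (3 + q))
  window-admissible q = allowed-pair q , allowed-pair (1 + q) , allowed-pair (2 + q)
    , no-231-at q , no-231-at (1 + q) , λ (e₀ , e₁) → no-square-2 q e₀ e₁

  no-132-frame : ∀ m → w 0 ≡ 1F → w m ≡ 3F → w (m + m) ≡ 2F
    → (∀ j → 1 ≤ j → j < m → w j ≡ w (j + m)) → ⊥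
  no-132-frame 0 e₁ e₃ _ _ = case trans (sym e₁) e₃ of λ ()
  no-132-frame 1 e₁ e₃ _ _ = case trans (sym (follows-1 0 e₁)) e₃ of λ ()
  no-132-frame 2 e₁ e₃ e₂ middle =
    no-10302-at 0 e₁ w₁≡0 e₃ (trans (sym (middle 1 ≤-refl ≤-refl)) w₁≡0) e₂
    where
    w₁≡0 : w 1 ≡ 0F
    w₁≡0 = follows-1 0 e₁
  no-132-frame 3 e₁ e₃ e₂ middle =
    neighbours-distinct 1 (trans (follows-1 0 e₁) (sym w₂≡0))
    where
    w₂≡0 : w 2 ≡ 0F
    w₂≡0 = trans (middle 2 (s≤s z≤n) ≤-refl) (precedes-2 5 e₂)
  -- The 3 at position m sits between two 0s; every choice of the letters at positions 2 and
  -- m - 2 then creates a square of period at most 2 or an occurrence of 10302.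
  no-132-frame m@(suc (suc (suc (suc k)))) e₁ e₃ e₂ middle = excluded (w 2) refl (w (2 + k)) refl
    where
    w₁≡0 : w 1 ≡ 0F
    w₁≡0 = follows-1 0 e₁
    w[m+1]≡0 : w (1 + m) ≡ 0F
    w[m+1]≡0 = trans (sym (middle 1 ≤-refl (s≤s (s≤s z≤n)))) w₁≡0
    w[2m-1]≡0 : w (3 + k + m) ≡ 0F
    w[2m-1]≡0 = precedes-2 (3 + k + m) e₂
    w[m-1]≡0 : w (3 + k) ≡ 0F
    w[m-1]≡0 = trans (middle (3 + k) (s≤s z≤n) ≤-refl) w[2m-1]≡0
    w[m+2]≡w₂ : w (2 + m) ≡ w 2
    w[m+2]≡w₂ = sym (middle 2 (s≤s z≤n) (s≤s (s≤s (s≤s z≤n))))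
    w[2m-2]≡w[m-2] : w (2 + k + m) ≡ w (2 + k)
    w[2m-2]≡w[m-2] = sym (middle (2 + k) (s≤s z≤n) (+-monoˡ-< k (s≤s (s≤s (s≤s z≤n)))))

    excluded : ∀ a → w 2 ≡ a → ∀ b → w (2 + k) ≡ b → ⊥
    excluded 0F e _  _  = neighbours-distinct 1 (trans w₁≡0 (sym e))
    excluded 1F e _  _  = no-square-2 0 (trans e₁ (sym e)) (trans w₁≡0 (sym (follows-1 2 e)))
    excluded 3F e _  _  =
      no-square-2 (3 + k) (trans w[m-1]≡0 (sym w[m+1]≡0)) (trans e₃ (sym (trans w[m+2]≡w₂ e)))
    excluded 2F _ 0F e′ = neighbours-distinct (2 + k) (trans e′ (sym w[m-1]≡0))
    excluded 2F e 1F e′ = no-10302-at (2 + k) e′ w[m-1]≡0 e₃ w[m+1]≡0 (trans w[m+2]≡w₂ e)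
    excluded 2F _ 3F e′ = no-square-2 (2 + k) (trans e′ (sym e₃)) (trans w[m-1]≡0 (sym w[m+1]≡0))
    excluded 2F _ 2F e′ = no-square-2 (1 + k + m)
      (trans (precedes-2 (1 + k + m) w[2m-2]≡2) (sym w[2m-1]≡0)) (trans w[2m-2]≡2 (sym e₂))
      where
      w[2m-2]≡2 : w (2 + k + m) ≡ 2F
      w[2m-2]≡2 = trans w[2m-2]≡w[m-2] e′

-- Both bit functions return the junk value 0F past the end of the image.
bit : Σ₄ → ℕ → Σ₂
bit x t with t <? 6
... | yes t<6 = vlookup (gImg x) (fromℕ< t<6)
... | no _    = 0F

bitAt : List Σ₄ → ℕ → Σ₂
bitAt []      _ = 0F
bitAt (x ∷ u) t with t <? 6
... | yes _ = bit x t
... | no _  = bitAt u (t ∸ 6)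

factor : {A : Set} → InfWord A → ℕ → ℕ → List A
factor w q zero    = []
factor w q (suc K) = w q ∷ factor w (suc q) K

applyUniform-block : ∀ {A B : Set} m (h : A → Vec B (suc m)) (w : InfWord A) q t
  (t<1+m : t < suc m) → applyUniform m h w (t + q * suc m) ≡ vlookup (h (w q)) (fromℕ< t<1+m)
applyUniform-block m h w q t t<1+m =
  cong₂ (λ j i → vlookup (h (w j)) i) quotient (fromℕ<-cong _ t remainder _ t<1+m)
  where
  quotient : (t + q * suc m) / suc m ≡ q
  quotient = begin
    (t + q * suc m) / suc m       ≡⟨ +-distrib-/-∣ʳ t (divides-refl q) ⟩
    t / suc m + q * suc m / suc m ≡⟨ cong₂ _+_ (m<n⇒m/n≡0 t<1+m) (m*n/n≡m q (suc m)) ⟩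
    q                             ∎
  remainder : (t + q * suc m) % suc m ≡ t
  remainder = trans ([m+kn]%n≡m%n t q (suc m)) (m<n⇒m%n≡m t<1+m)

g-block : ∀ w q t → t < 6 → g w (t + q * 6) ≡ bit (w q) t
g-block w q t t<6 with t <? 6
... | yes t<6′ = trans (applyUniform-block 5 gImg w q t t<6)
                       (cong (vlookup (gImg (w q))) (fromℕ<-cong t t refl t<6 t<6′))
... | no t≮6   = contradiction t<6 t≮6

g-factor : ∀ w K q t → t < K * 6 → g w (t + q * 6) ≡ bitAt (factor w q K) t
g-factor w (suc K) q t t<[1+K]6 with t <? 6
... | yes t<6 = g-block w q t t<6
... | no t≮6  = begin
  g w (t + q * 6)                    ≡⟨ cong (λ x → g w (x + q * 6)) (m∸n+n≡m 6≤t) ⟨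
  g w (t ∸ 6 + 6 + q * 6)            ≡⟨ cong (g w) (+-assoc (t ∸ 6) 6 (q * 6)) ⟩
  g w (t ∸ 6 + suc q * 6)            ≡⟨ g-factor w K (suc q) (t ∸ 6) t∸6<K6 ⟩
  bitAt (factor w (suc q) K) (t ∸ 6) ∎
  where
  6≤t : 6 ≤ t
  6≤t = ≮⇒≥ t≮6
  t∸6<K6 : t ∸ 6 < K * 6
  t∸6<K6 = subst (t ∸ 6 <_) (m+n∸m≡n 6 (K * 6)) (∸-monoˡ-< t<[1+K]6 6≤t)

g-window : ∀ w i o → o ≤ 18 → g w (i + o) ≡ bitAt (factor w (i / 6) 4) (i % 6 + o)
g-window w i o o≤18 = begin
  g w (i + o)                            ≡⟨ cong (λ x → g w (x + o)) (m≡m%n+[m/n]*n i 6) ⟩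
  g w (i % 6 + i / 6 * 6 + o)            ≡⟨ cong (g w) (xy∙z≈xz∙y (i % 6) (i / 6 * 6) o) ⟩
  g w (i % 6 + o + i / 6 * 6)            ≡⟨ g-factor w 4 (i / 6) (i % 6 + o) in-window ⟩
  bitAt (factor w (i / 6) 4) (i % 6 + o) ∎
  where
  in-window : i % 6 + o < 4 * 6
  in-window = +-mono-<-≤ (m%n<n i 6) o≤18

block-agrees : ∀ w q r m → PowerAt (g w) 2 (m * 6) (r + q * 6)
  → ∀ j t → t < 6 → r ≤ t + j * 6 → t + j * 6 < r + m * 6
  → bit (w (q + j)) t ≡ bit (w (q + (j + m))) t
block-agrees w q r m P j t t<6 lo hi = begin
  bit (w (q + j)) t             ≡⟨ g-block w (q + j) t t<6 ⟨
  g w (t + (q + j) * 6)         ≡⟨ square-periodic-interval (g w) (m * 6) (r + q * 6) P _ i≤p p<i+n ⟩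
  g w (t + (q + j) * 6 + m * 6) ≡⟨ cong (g w) (shifted t q j m) ⟩
  g w (t + (q + (j + m)) * 6)   ≡⟨ g-block w (q + (j + m)) t t<6 ⟩
  bit (w (q + (j + m))) t       ∎
  where
  position : ∀ t q j → t + (q + j) * 6 ≡ t + j * 6 + q * 6
  position = solve-∀
  shuffle : ∀ r m q → r + m * 6 + q * 6 ≡ r + q * 6 + m * 6
  shuffle = solve-∀
  shifted : ∀ t q j m → t + (q + j) * 6 + m * 6 ≡ t + (q + (j + m)) * 6
  shifted = solve-∀
  i≤p : r + q * 6 ≤ t + (q + j) * 6
  i≤p = subst (r + q * 6 ≤_) (sym (position t q j)) (+-monoˡ-≤ (q * 6) lo)
  p<i+n : t + (q + j) * 6 < r + q * 6 + m * 6
  p<i+n = subst₂ _<_ (sym (position t q j)) (shuffle r m q) (+-monoˡ-< (q * 6) hi)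

PeriodBroken : List Σ₄ → (r s n : ℕ) → Set
PeriodBroken u r s n = ∃ λ k → k < s × bitAt u (r + k) ≢ bitAt u (r + k + n)

period-broken? : ∀ u r s n → Dec (PeriodBroken u r s n)
period-broken? u r s n = anyUpTo? (λ k → ¬? (bitAt u (r + k) Fin.≟ bitAt u (r + k + n))) s

-- The offset inside its block at which each 9-bit factor of the image of an admissible word
-- starts (read off from all such images); 9 is a junk value for bit strings that never occur.
phase₉ : Vec Σ₂ 9 → ℕ
phase₉ (0F ∷ᵛ 0F ∷ᵛ 1F ∷ᵛ 0F ∷ᵛ 0F ∷ᵛ 1F ∷ᵛ 1F ∷ᵛ 0F ∷ᵛ 1F ∷ᵛ []ᵛ) = 5
phase₉ (0F ∷ᵛ 0F ∷ᵛ 1F ∷ᵛ 0F ∷ᵛ 1F ∷ᵛ 0F ∷ᵛ 0F ∷ᵛ 1F ∷ᵛ 1F ∷ᵛ []ᵛ) = 3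
phase₉ (0F ∷ᵛ 0F ∷ᵛ 1F ∷ᵛ 0F ∷ᵛ 1F ∷ᵛ 1F ∷ᵛ 0F ∷ᵛ 0F ∷ᵛ 1F ∷ᵛ []ᵛ) = 5
phase₉ (0F ∷ᵛ 0F ∷ᵛ 1F ∷ᵛ 0F ∷ᵛ 1F ∷ᵛ 1F ∷ᵛ 0F ∷ᵛ 1F ∷ᵛ 0F ∷ᵛ []ᵛ) = 3
phase₉ (0F ∷ᵛ 0F ∷ᵛ 1F ∷ᵛ 1F ∷ᵛ 0F ∷ᵛ 1F ∷ᵛ 0F ∷ᵛ 1F ∷ᵛ 1F ∷ᵛ []ᵛ) = 2
phase₉ (0F ∷ᵛ 0F ∷ᵛ 1F ∷ᵛ 1F ∷ᵛ 0F ∷ᵛ 1F ∷ᵛ 1F ∷ᵛ 0F ∷ᵛ 0F ∷ᵛ []ᵛ) = 2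
phase₉ (0F ∷ᵛ 0F ∷ᵛ 1F ∷ᵛ 1F ∷ᵛ 0F ∷ᵛ 1F ∷ᵛ 1F ∷ᵛ 0F ∷ᵛ 1F ∷ᵛ []ᵛ) = 2
phase₉ (0F ∷ᵛ 1F ∷ᵛ 0F ∷ᵛ 0F ∷ᵛ 1F ∷ᵛ 0F ∷ᵛ 0F ∷ᵛ 1F ∷ᵛ 1F ∷ᵛ []ᵛ) = 3
phase₉ (0F ∷ᵛ 1F ∷ᵛ 0F ∷ᵛ 0F ∷ᵛ 1F ∷ᵛ 0F ∷ᵛ 1F ∷ᵛ 1F ∷ᵛ 0F ∷ᵛ []ᵛ) = 3
phase₉ (0F ∷ᵛ 1F ∷ᵛ 0F ∷ᵛ 0F ∷ᵛ 1F ∷ᵛ 1F ∷ᵛ 0F ∷ᵛ 1F ∷ᵛ 0F ∷ᵛ []ᵛ) = 0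
phase₉ (0F ∷ᵛ 1F ∷ᵛ 0F ∷ᵛ 0F ∷ᵛ 1F ∷ᵛ 1F ∷ᵛ 0F ∷ᵛ 1F ∷ᵛ 1F ∷ᵛ []ᵛ) = 0
phase₉ (0F ∷ᵛ 1F ∷ᵛ 0F ∷ᵛ 1F ∷ᵛ 0F ∷ᵛ 0F ∷ᵛ 1F ∷ᵛ 1F ∷ᵛ 0F ∷ᵛ []ᵛ) = 4
phase₉ (0F ∷ᵛ 1F ∷ᵛ 0F ∷ᵛ 1F ∷ᵛ 1F ∷ᵛ 0F ∷ᵛ 0F ∷ᵛ 1F ∷ᵛ 0F ∷ᵛ []ᵛ) = 0
phase₉ (0F ∷ᵛ 1F ∷ᵛ 0F ∷ᵛ 1F ∷ᵛ 1F ∷ᵛ 0F ∷ᵛ 1F ∷ᵛ 0F ∷ᵛ 0F ∷ᵛ []ᵛ) = 4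
phase₉ (0F ∷ᵛ 1F ∷ᵛ 1F ∷ᵛ 0F ∷ᵛ 0F ∷ᵛ 1F ∷ᵛ 0F ∷ᵛ 0F ∷ᵛ 1F ∷ᵛ []ᵛ) = 2
phase₉ (0F ∷ᵛ 1F ∷ᵛ 1F ∷ᵛ 0F ∷ᵛ 0F ∷ᵛ 1F ∷ᵛ 0F ∷ᵛ 1F ∷ᵛ 0F ∷ᵛ []ᵛ) = 0
phase₉ (0F ∷ᵛ 1F ∷ᵛ 1F ∷ᵛ 0F ∷ᵛ 0F ∷ᵛ 1F ∷ᵛ 0F ∷ᵛ 1F ∷ᵛ 1F ∷ᵛ []ᵛ) = 0
phase₉ (0F ∷ᵛ 1F ∷ᵛ 1F ∷ᵛ 0F ∷ᵛ 1F ∷ᵛ 0F ∷ᵛ 0F ∷ᵛ 1F ∷ᵛ 0F ∷ᵛ []ᵛ) = 0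
phase₉ (0F ∷ᵛ 1F ∷ᵛ 1F ∷ᵛ 0F ∷ᵛ 1F ∷ᵛ 0F ∷ᵛ 1F ∷ᵛ 1F ∷ᵛ 0F ∷ᵛ []ᵛ) = 3
phase₉ (0F ∷ᵛ 1F ∷ᵛ 1F ∷ᵛ 0F ∷ᵛ 1F ∷ᵛ 1F ∷ᵛ 0F ∷ᵛ 0F ∷ᵛ 1F ∷ᵛ []ᵛ) = 3
phase₉ (0F ∷ᵛ 1F ∷ᵛ 1F ∷ᵛ 0F ∷ᵛ 1F ∷ᵛ 1F ∷ᵛ 0F ∷ᵛ 1F ∷ᵛ 0F ∷ᵛ []ᵛ) = 3
phase₉ (1F ∷ᵛ 0F ∷ᵛ 0F ∷ᵛ 1F ∷ᵛ 0F ∷ᵛ 0F ∷ᵛ 1F ∷ᵛ 1F ∷ᵛ 0F ∷ᵛ []ᵛ) = 4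
phase₉ (1F ∷ᵛ 0F ∷ᵛ 0F ∷ᵛ 1F ∷ᵛ 0F ∷ᵛ 1F ∷ᵛ 0F ∷ᵛ 0F ∷ᵛ 1F ∷ᵛ []ᵛ) = 2
phase₉ (1F ∷ᵛ 0F ∷ᵛ 0F ∷ᵛ 1F ∷ᵛ 0F ∷ᵛ 1F ∷ᵛ 1F ∷ᵛ 0F ∷ᵛ 0F ∷ᵛ []ᵛ) = 4
phase₉ (1F ∷ᵛ 0F ∷ᵛ 0F ∷ᵛ 1F ∷ᵛ 0F ∷ᵛ 1F ∷ᵛ 1F ∷ᵛ 0F ∷ᵛ 1F ∷ᵛ []ᵛ) = 2
phase₉ (1F ∷ᵛ 0F ∷ᵛ 0F ∷ᵛ 1F ∷ᵛ 1F ∷ᵛ 0F ∷ᵛ 1F ∷ᵛ 0F ∷ᵛ 1F ∷ᵛ []ᵛ) = 1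
phase₉ (1F ∷ᵛ 0F ∷ᵛ 0F ∷ᵛ 1F ∷ᵛ 1F ∷ᵛ 0F ∷ᵛ 1F ∷ᵛ 1F ∷ᵛ 0F ∷ᵛ []ᵛ) = 1
phase₉ (1F ∷ᵛ 0F ∷ᵛ 1F ∷ᵛ 0F ∷ᵛ 0F ∷ᵛ 1F ∷ᵛ 0F ∷ᵛ 0F ∷ᵛ 1F ∷ᵛ []ᵛ) = 2
phase₉ (1F ∷ᵛ 0F ∷ᵛ 1F ∷ᵛ 0F ∷ᵛ 0F ∷ᵛ 1F ∷ᵛ 0F ∷ᵛ 1F ∷ᵛ 1F ∷ᵛ []ᵛ) = 2
phase₉ (1F ∷ᵛ 0F ∷ᵛ 1F ∷ᵛ 0F ∷ᵛ 0F ∷ᵛ 1F ∷ᵛ 1F ∷ᵛ 0F ∷ᵛ 1F ∷ᵛ []ᵛ) = 5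
phase₉ (1F ∷ᵛ 0F ∷ᵛ 1F ∷ᵛ 0F ∷ᵛ 1F ∷ᵛ 1F ∷ᵛ 0F ∷ᵛ 0F ∷ᵛ 1F ∷ᵛ []ᵛ) = 5
phase₉ (1F ∷ᵛ 0F ∷ᵛ 1F ∷ᵛ 1F ∷ᵛ 0F ∷ᵛ 0F ∷ᵛ 1F ∷ᵛ 0F ∷ᵛ 0F ∷ᵛ []ᵛ) = 1
phase₉ (1F ∷ᵛ 0F ∷ᵛ 1F ∷ᵛ 1F ∷ᵛ 0F ∷ᵛ 0F ∷ᵛ 1F ∷ᵛ 0F ∷ᵛ 1F ∷ᵛ []ᵛ) = 5
phase₉ (1F ∷ᵛ 0F ∷ᵛ 1F ∷ᵛ 1F ∷ᵛ 0F ∷ᵛ 1F ∷ᵛ 0F ∷ᵛ 0F ∷ᵛ 1F ∷ᵛ []ᵛ) = 5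
phase₉ (1F ∷ᵛ 1F ∷ᵛ 0F ∷ᵛ 0F ∷ᵛ 1F ∷ᵛ 0F ∷ᵛ 0F ∷ᵛ 1F ∷ᵛ 1F ∷ᵛ []ᵛ) = 3
phase₉ (1F ∷ᵛ 1F ∷ᵛ 0F ∷ᵛ 0F ∷ᵛ 1F ∷ᵛ 0F ∷ᵛ 1F ∷ᵛ 0F ∷ᵛ 0F ∷ᵛ []ᵛ) = 1
phase₉ (1F ∷ᵛ 1F ∷ᵛ 0F ∷ᵛ 0F ∷ᵛ 1F ∷ᵛ 0F ∷ᵛ 1F ∷ᵛ 1F ∷ᵛ 0F ∷ᵛ []ᵛ) = 1
phase₉ (1F ∷ᵛ 1F ∷ᵛ 0F ∷ᵛ 1F ∷ᵛ 0F ∷ᵛ 0F ∷ᵛ 1F ∷ᵛ 0F ∷ᵛ 0F ∷ᵛ []ᵛ) = 1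
phase₉ (1F ∷ᵛ 1F ∷ᵛ 0F ∷ᵛ 1F ∷ᵛ 0F ∷ᵛ 0F ∷ᵛ 1F ∷ᵛ 0F ∷ᵛ 1F ∷ᵛ []ᵛ) = 1
phase₉ (1F ∷ᵛ 1F ∷ᵛ 0F ∷ᵛ 1F ∷ᵛ 0F ∷ᵛ 1F ∷ᵛ 1F ∷ᵛ 0F ∷ᵛ 0F ∷ᵛ []ᵛ) = 4
phase₉ (1F ∷ᵛ 1F ∷ᵛ 0F ∷ᵛ 1F ∷ᵛ 1F ∷ᵛ 0F ∷ᵛ 0F ∷ᵛ 1F ∷ᵛ 0F ∷ᵛ []ᵛ) = 4
phase₉ (1F ∷ᵛ 1F ∷ᵛ 0F ∷ᵛ 1F ∷ᵛ 1F ∷ᵛ 0F ∷ᵛ 1F ∷ᵛ 0F ∷ᵛ 0F ∷ᵛ []ᵛ) = 4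
phase₉ _ = 9

phase : (ℕ → Σ₂) → ℕ
phase f = phase₉ (tabulate (f ∘ toℕ))

phase-cong : ∀ {f f′} → (∀ t → t < 9 → f t ≡ f′ t) → phase f ≡ phase f′
phase-cong h = cong phase₉ (tabulate-cong λ t → h (toℕ t) (toℕ<n t))

admissible₄? : ∀ a b c d → Dec (Admissible₄ a b c d)
admissible₄? a b c d = T? (allowed a b) ×-dec T? (allowed b c) ×-dec T? (allowed c d)
  ×-dec ¬? (a Fin.≟ 2F ×-dec b Fin.≟ 3F ×-dec c Fin.≟ 1F)
  ×-dec ¬? (b Fin.≟ 2F ×-dec c Fin.≟ 3F ×-dec d Fin.≟ 1F)
  ×-dec ¬? (a Fin.≟ c ×-dec b Fin.≟ d)

all-admissible₄? : {P : Σ₄ → Σ₄ → Σ₄ → Σ₄ → Set} → (∀ a b c d → Dec (P a b c d))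
  → Dec (∀ a b c d → Admissible₄ a b c d → P a b c d)
all-admissible₄? P? =
  all? λ a → all? λ b → all? λ c → all? λ d → admissible₄? a b c d →-dec P? a b c d

window-breaks-short-squares : ∀ a b c d → Admissible₄ a b c d
  → ∀ {r} → r < 6 → ∀ {n} → n < 9 → 4 ≤ n → PeriodBroken (a ∷ b ∷ c ∷ d ∷ []) r n n
window-breaks-short-squares = toWitness {a? = all-admissible₄? λ a b c d → allUpTo? (λ r →
  allUpTo? (λ n → 4 ≤? n →-dec period-broken? (a ∷ b ∷ c ∷ d ∷ []) r n n) 9) 6} _

window-breaks-short-cubes : ∀ a b c d → Admissible₄ a b c d
  → ∀ {r} → r < 6 → ∀ {n} → n < 4 → 1 ≤ n → PeriodBroken (a ∷ b ∷ c ∷ d ∷ []) r (2 * n) n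
window-breaks-short-cubes = toWitness {a? = all-admissible₄? λ a b c d → allUpTo? (λ r →
  allUpTo? (λ n → 1 ≤? n →-dec period-broken? (a ∷ b ∷ c ∷ d ∷ []) r (2 * n) n) 4) 6} _

window-phase : ∀ a b c d → Admissible₄ a b c d
  → ∀ {r} → r < 6 → phase (λ t → bitAt (a ∷ b ∷ c ∷ d ∷ []) (r + t)) ≡ r
window-phase = toWitness {a? = all-admissible₄? λ a b c d →
  allUpTo? (λ r → phase (λ t → bitAt (a ∷ b ∷ c ∷ d ∷ []) (r + t)) ≟ r) 6} _

bit-injective : ∀ a b → (∀ {t} → t < 6 → bit a t ≡ bit b t) → a ≡ b
bit-injective = toWitness {a? = all? λ a → all? λ b →
  allUpTo? (λ t → bit a t Fin.≟ bit b t) 6 →-dec a Fin.≟ b} _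

-- The non-trivial solution: g(3) = 0110·10 is the prefix 0110 of g(2) followed by the suffix 10
-- of g(1).
overlapping-images : ∀ a b c {r} → r < 6 → (∀ {t} → t < 6 → r ≤ t → bit a t ≡ bit b t)
  → (∀ {t} → t < r → bit b t ≡ bit c t) → a ≡ b ⊎ b ≡ c ⊎ (a ≡ 1F × b ≡ 3F × c ≡ 2F)
overlapping-images = toWitness {a? = all? λ a → all? λ b → all? λ c → allUpTo? (λ r →
    allUpTo? (λ t → r ≤? t →-dec bit a t Fin.≟ bit b t) 6
    →-dec allUpTo? (λ t → bit b t Fin.≟ bit c t) r
    →-dec (a Fin.≟ b ⊎-dec b Fin.≟ c ⊎-dec a Fin.≟ 1F ×-dec b Fin.≟ 3F ×-dec c Fin.≟ 2F)) 6} _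

module ImageOfAdmissible {w : InfWord Σ₄} (adm : Admissible w) where
  open AdmissibleLetters adm using (window-admissible)

  -- s + n ≤ 19 keeps all compared bits inside the 24 bits of g(factor w (i / 6) 4).
  broken-window : ∀ i {s n} → s + n ≤ 19 → PeriodBroken (factor w (i / 6) 4) (i % 6) s n
    → ¬ (∀ k → k < s → g w (i + k) ≡ g w (i + k + n))
  broken-window i {s} {n} s+n≤19 (k , k<s , mismatch) periodic = mismatch (begin
    bitAt u (r + k)       ≡⟨ g-window w i k (≤-trans (m≤m+n k n) k+n≤18) ⟨
    g w (i + k)           ≡⟨ periodic k k<s ⟩
    g w (i + k + n)       ≡⟨ cong (g w) (+-assoc i k n) ⟩
    g w (i + (k + n))     ≡⟨ g-window w i (k + n) k+n≤18 ⟩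
    bitAt u (r + (k + n)) ≡⟨ cong (bitAt u) (+-assoc r k n) ⟨
    bitAt u (r + k + n)   ∎)
    where
    u : List Σ₄
    u = factor w (i / 6) 4
    r : ℕ
    r = i % 6
    k+n≤18 : k + n ≤ 18
    k+n≤18 = ≤-pred (≤-trans (+-monoˡ-< n k<s) s+n≤19)

  no-short-square : ∀ {n} → 4 ≤ n → n < 9 → ¬ HasSquareOfLength (g w) n
  no-short-square {n} 4≤n n<9 (i , P) =
    broken-window i (≤-trans (+-mono-≤ n≤8 n≤8) (m≤m+n 16 3))
      (window-breaks-short-squares _ _ _ _ (window-admissible (i / 6)) (m%n<n i 6) n<9 4≤n)
      (square-periodic (g w) n i P)
    where
    n≤8 : n ≤ 8
    n≤8 = ≤-pred n<9

  no-short-cube : ∀ {n} → 1 ≤ n → n < 4 → ¬ ∃ (PowerAt (g w) 3 n)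
  no-short-cube {n} 1≤n n<4 (i , P) =
    broken-window i (≤-trans (+-mono-≤ (*-monoʳ-≤ 2 n≤3) n≤3) (m≤m+n 9 10))
      (window-breaks-short-cubes _ _ _ _ (window-admissible (i / 6)) (m%n<n i 6) n<4 1≤n)
      (PowerAt-periodic (g w) 2 n i P)
    where
    n≤3 : n ≤ 3
    n≤3 = ≤-pred n<4

  phase-at : ∀ i → phase (λ t → g w (i + t)) ≡ i % 6
  phase-at i = trans
    (phase-cong λ t t<9 → g-window w i t (≤-trans (<⇒≤ t<9) (m≤m+n 9 9)))
    (window-phase _ _ _ _ (window-admissible (i / 6)) (m%n<n i 6))

  long-square-phase : ∀ n i → 9 ≤ n → PowerAt (g w) 2 n i → i % 6 ≡ (i + n) % 6
  long-square-phase n i n≥9 P = begin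
    i % 6                         ≡⟨ phase-at i ⟨
    phase (λ t → g w (i + t))     ≡⟨ phase-cong shifted-window ⟩
    phase (λ t → g w (i + n + t)) ≡⟨ phase-at (i + n) ⟩
    (i + n) % 6                   ∎
    where
    shifted-window : ∀ t → t < 9 → g w (i + t) ≡ g w (i + n + t)
    shifted-window t t<9 =
      trans (square-periodic (g w) n i P t (<-≤-trans t<9 n≥9)) (cong (g w) (xy∙z≈xz∙y i t n))

  no-aligned-square : ∀ q r m → r < 6 → 1 ≤ m → ¬ PowerAt (g w) 2 (m * 6) (r + q * 6)
  no-aligned-square q r m r<6 1≤m P =
    [ repeated-first , [ repeated-last , frame ]′ ]′
      (overlapping-images (v 0) (v m) (v (m + m)) r<6 first last)
    where
    v : InfWord Σ₄
    v = shift q w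
    open AdmissibleLetters (Admissible-shift q adm) using (no-square; no-132-frame)

    middle : ∀ j → 1 ≤ j → j < m → v j ≡ v (j + m)
    middle j 1≤j j<m = bit-injective (v j) (v (j + m)) λ {t} t<6 → block-agrees w q r m P j t t<6
      (≤-trans (<⇒≤ r<6) (≤-trans (*-monoˡ-≤ 6 1≤j) (m≤n+m (j * 6) t)))
      (<-≤-trans (+-monoˡ-< (j * 6) t<6) (≤-trans (*-monoˡ-≤ 6 j<m) (m≤n+m (m * 6) r)))

    first : ∀ {t} → t < 6 → r ≤ t → bit (v 0) t ≡ bit (v m) t
    first {t} t<6 r≤t = block-agrees w q r m P 0 t t<6 (≤-trans r≤t (m≤m+n t 0))
      (<-≤-trans (+-monoˡ-< 0 t<6) (≤-trans (*-monoˡ-≤ 6 1≤m) (m≤n+m (m * 6) r)))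

    last : ∀ {t} → t < r → bit (v m) t ≡ bit (v (m + m)) t
    last {t} t<r = block-agrees w q r m P m t (<-trans t<r r<6)
      (≤-trans (<⇒≤ r<6) (≤-trans (*-monoˡ-≤ 6 1≤m) (m≤n+m (m * 6) t)))
      (+-monoˡ-< (m * 6) t<r)

    repeated-first : v 0 ≢ v m
    repeated-first e = no-square 0 1≤m λ where
      zero    _   → e
      (suc k) k<m → middle (suc k) (s≤s z≤n) k<m

    repeated-last : v m ≢ v (m + m)
    repeated-last e = no-square 1 1≤m λ k k<m → case m≤n⇒m<n∨m≡n k<m of λ where
      (inj₁ 1+k<m) → middle (suc k) (s≤s z≤n) 1+k<m
      (inj₂ 1+k≡m) → subst (λ x → v x ≡ v (x + m)) (sym 1+k≡m) e

    frame : ¬ (v 0 ≡ 1F × v m ≡ 3F × v (m + m) ≡ 2F)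
    frame (e₁ , e₃ , e₂) = no-132-frame m e₁ e₃ e₂ middle

  no-long-square : ∀ {n} → 9 ≤ n → ¬ HasSquareOfLength (g w) n
  no-long-square {n} n≥9 (i , P) = aligned (%-equal⇒∣ 6 i n (long-square-phase n i n≥9 P))
    where
    positive : ∀ m → 9 ≤ m * 6 → 1 ≤ m
    positive (suc _) _ = s≤s z≤n
    aligned : 6 ∣ n → ⊥
    aligned (divides m n≡m*6) = no-aligned-square (i / 6) (i % 6) m (m%n<n i 6)
      (positive m (subst (9 ≤_) n≡m*6 n≥9)) (subst₂ (PowerAt (g w) 2) n≡m*6 (m≡m%n+[m/n]*n i 6) P)

  no-square-≥4 : (n : ℕ) → n ≥ 4 → ¬ HasSquareOfLength (g w) n
  no-square-≥4 n n≥4 with n <? 9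
  ... | yes n<9 = no-short-square n≥4 n<9
  ... | no n≮9  = no-long-square (≮⇒≥ n≮9)

  cubefree : Cubefree (g w)
  cubefree n 1≤n (i , P) with n <? 4
  ... | yes n<4 = no-short-cube 1≤n n<4 (i , P)
  ... | no n≮4  = no-square-≥4 n (≮⇒≥ n≮4) (i , PowerAt-mono (g w) n i (n≤1+n 2) P)

theorem3 : (w : InfWord Σ₄) → Squarefree w
    → ¬ Contains w (1F ∷ 2F ∷ [])
    → ¬ Contains w (1F ∷ 3F ∷ [])
    → ¬ Contains w (2F ∷ 1F ∷ [])
    → ¬ Contains w (3F ∷ 2F ∷ [])
    → ¬ Contains w (2F ∷ 3F ∷ 1F ∷ [])
    → ¬ Contains w (1F ∷ 0F ∷ 3F ∷ 0F ∷ 2F ∷ [])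
    → Cubefree (g w) × ((n : _) → n ≥ 4 → ¬ HasSquareOfLength (g w) n)
theorem3 w squarefree no-12 no-13 no-21 no-32 no-231 no-10302 = cubefree , no-square-≥4
  where
  admissible : Admissible w
  admissible = record
    { squarefree = squarefree ; no-12 = no-12 ; no-13 = no-13 ; no-21 = no-21
    ; no-32 = no-32 ; no-231 = no-231 ; no-10302 = no-10302 }
  open ImageOfAdmissible admissible
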